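{- Let $G$ be a finite simple graph and $s \geq 1$ an integer, and let $H_c = \{v \in V(G) \mid c(v) \geq s\}$. Then $G$ attains equality in the bound \[ N(G,K_s) \leq \left(\sum_{v\in V(G)}\frac{1}{c(v)-1}\binom{c(v)}{s}\right) - \frac{1}{c(u)-1}\binom{c(u)}{s} \] (where $u$ is a vertex with $c(u)=\max_{v\in V(G)} c(v)$) if and only if the induced subgraph $G[H_c]$ attains equality in the same bound applied to $G[H_c]$ (with weights and the maximum-weight vertex taken in $G[H_c]$).
   Context: $N(G,K_s)$ denotes the number of subgraphs of $G$ isomorphic to $K_s$. For a graph $H$ and $v\in V(H)$, $c(v)$ is the length of the longest cycle of $H$ containing $v$, or $2$ if $v$ lies on no cycle. Binomial coefficients $\binom{a}{b}$ are $0$ when $a<b$. -}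

module Defs where

open import Data.Bool using (Bool; true; false; _∧_; not; if_then_else_)
open import Data.Nat using (ℕ; zero; suc; _∸_; _⊔_; _≤ᵇ_; _≡ᵇ_)
open import Data.Nat.Combinatorics using (_C_)
open import Data.Fin using (Fin; _≟_)
open import Data.List using (List; []; _∷_; _++_; map; foldr; length; concatMap; upTo; allFin)
open import Data.Bool.ListAction using (any; all)
open import Data.Integer using (+_)
open import Data.Rational using (ℚ; _/_; _+_; _-_; 0ℚ)
open import Relation.Nullary.Decidable using (⌊_⌋)
open import Relation.Binary.PropositionalEquality using (_≡_)

record Graph (n : ℕ) : Set where
  field
    adj    : Fin n → Fin n → Bool
    sym    : ∀ i j → adj i j ≡ adj j i
    irrefl : ∀ i → adj i i ≡ false
open Graph public

VSet : ℕ → Set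
VSet n = Fin n → Bool

full : ∀ {n} → VSet n
full _ = true

-- Graph quantities of the INDUCED subgraph G[S]
-- (for S = full these are the quantities of G itself).
module _ {n : ℕ} (G : Graph n) (S : VSet n) where

  lists : ℕ → List (List (Fin n))
  lists zero    = [] ∷ []
  lists (suc k) = concatMap (λ xs → map (_∷ xs) (allFin n)) (lists k)

  memB : Fin n → List (Fin n) → Bool
  memB v xs = any (λ x → ⌊ x ≟ v ⌋) xs

  distinctB : List (Fin n) → Bool
  distinctB []       = true
  distinctB (x ∷ xs) = not (memB x xs) ∧ distinctB xs

  closedB : Fin n → List (Fin n) → Bool
  closedB first []           = false
  closedB first (x ∷ [])     = adj G x first
  closedB first (x ∷ y ∷ xs) = adj G x y ∧ closedB first (y ∷ xs)

  isCycleB : List (Fin n) → Bool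
  isCycleB []       = false
  isCycleB (x ∷ xs) = (3 ≤ᵇ length (x ∷ xs)) ∧ distinctB (x ∷ xs)
                      ∧ all S (x ∷ xs) ∧ closedB x (x ∷ xs)

  -- all vertex sequences of length ≤ n (every cycle has length ≤ n)
  candidates : List (List (Fin n))
  candidates = concatMap lists (upTo (suc n))

  -- c(v): length of a longest cycle of G[S] through v, or 2 if none.
  c : Fin n → ℕ
  c v = foldr (λ xs acc → if isCycleB xs ∧ memB v xs then length xs ⊔ acc else acc)
              2 candidates

  subsets : List (Fin n) → List (List (Fin n))
  subsets []       = [] ∷ []
  subsets (x ∷ xs) = subsets xs ++ map (x ∷_) (subsets xs)

  cliqueB : List (Fin n) → Bool
  cliqueB []       = true
  cliqueB (x ∷ xs) = S x ∧ all (adj G x) xs ∧ cliqueB xs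

  countB : List (List (Fin n)) → (List (Fin n) → Bool) → ℕ
  countB []       p = 0
  countB (x ∷ xs) p = if p x then suc (countB xs p) else countB xs p

  NK : ℕ → ℕ
  NK s = countB (subsets (allFin n)) (λ T → (length T ≡ᵇ s) ∧ cliqueB T)

  verts : List (Fin n)
  verts = foldr (λ v acc → if S v then v ∷ acc else acc) [] (allFin n)

  -- weight  (1/(k-1)) · binom(k, s); the denominator is written
  -- suc (k ∸ 2), which equals k - 1 since every value of c is ≥ 2.
  weight : ℕ → ℕ → ℚ
  weight s k = (+ (k C s)) / suc (k ∸ 2)

  maxc : ℕ
  maxc = foldr (λ v acc → c v ⊔ acc) 0 verts

  -- the right-hand side of the bound for G[S]:
  --   Σ_v weight(c v) − weight(c u),  c(u) = max c.
  -- (For empty S the subtracted term is taken to be 0.)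
  bound : ℕ → ℚ
  bound s = foldr (λ v acc → weight s (c v) + acc) 0ℚ verts
            - subtracted verts
    where
      subtracted : List (Fin n) → ℚ
      subtracted []      = 0ℚ
      subtracted (_ ∷ _) = weight s maxc

  AttainsEq : ℕ → Set
  AttainsEq s = (+ NK s) / 1 ≡ bound s

Hc : ∀ {n} → Graph n → ℕ → VSet n
Hc G s v = s ≤ᵇ c G full v

{-# OPTIONS --safe #-}
-- Both sides of the equivalence are in fact equal. A longest cycle of G through v passes only
-- through vertices w with c(w) ≥ c(v); so when c(v) ≥ s it lies in G[H_c], and c computed in
-- G[H_c] agrees with c computed in G on H_c. A vertex outside H_c has c(v) < s and hence weight
-- binom(c(v), s)/(c(v) − 1) = 0, so the two weight sums agree; the subtracted maximal weights
-- agree as well, being 0 on both sides when max c < s. Finally every copy of K_s lies in H_c: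
-- for s ≥ 3 its vertices form a cycle of length s, and for s ≤ 2 every vertex has c ≥ 2 ≥ s.
module Submission where

open import Defs hiding (sym)
open import Data.Bool using (Bool; true; false; T; not; _∧_; if_then_else_)
open import Data.Bool.Properties using (T-∧; T-≡; ∧-assoc; ∧-comm; ∧-zeroʳ)
open import Data.Bool.ListAction using (all)
open import Data.Empty using (⊥-elim)
open import Data.Fin using (Fin)
open import Data.List using (List; []; _∷_; length; foldr; map; concat; concatMap; allFin; upTo; _++_)
open import Data.List.Properties using (map-cong; length-tabulate)
open import Data.List.Membership.Propositional using (_∈_)
open import Data.List.Membership.Propositional.Properties
  using (∈-map⁺; ∈-map⁻; ∈-++⁻; ∈-concat⁺′; ∈-upTo⁺; ∈-allFin)
open import Data.List.Relation.Unary.All as All using (All; []; _∷_)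
open import Data.List.Relation.Unary.All.Properties using (all⁺; all⁻)
open import Data.List.Relation.Unary.Any as Any using (here; there)
open import Data.List.Relation.Unary.Any.Properties using (any⁺; any⁻)
open import Data.Nat using (ℕ; suc; _≤_; _<_; _⊔_; _≤ᵇ_; _≡ᵇ_; _∸_; _≤?_; z≤n; s≤s)
open import Data.Nat.Properties
  using (≤-refl; ≤-pred; ≤-trans; ≤-antisym; ≤-total; <⇒≤; <⇒≱; ≰⇒>; ≮⇒≥; ≤-<-trans;
         n≤1+n; m≤m⊔n; m≤n⊔m; m≤n⇒m⊔n≡n; m≥n⇒m⊔n≡m; ⊔-identityʳ; ⊔-pres-<m;
         ≤⇒≤ᵇ; ≤ᵇ-reflects-≤; ≡ᵇ⇒≡)
open import Data.Product using (_×_; _,_; proj₁; proj₂; ∃-syntax)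
open import Data.Sum using (_⊎_; inj₁; inj₂)
open import Data.Integer using (+_)
open import Data.Rational using (ℚ; 0ℚ; _+_; _-_; _/_)
open import Data.Rational.Properties using (+-identityˡ; 0/n≡0)
open import Data.Nat.Combinatorics.Specification using (k>n⇒nCk≡0)
open import Function using (_∘_; Equivalence)
open import Function.Bundles using (_⇔_; mk⇔)
open import Relation.Binary.PropositionalEquality
  using (_≡_; refl; sym; trans; cong; cong₂; subst; subst₂; module ≡-Reasoning)
open import Relation.Nullary using (Dec; yes; no)
open import Relation.Nullary.Decidable using (toWitness; fromWitness)
open import Relation.Nullary.Reflects using (ofʸ; ofⁿ)

open Equivalence using (to; from)

∧-pull-third : ∀ a b c d → a ∧ (b ∧ (c ∧ d)) ≡ (a ∧ (b ∧ d)) ∧ c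
∧-pull-third false b     c d = refl
∧-pull-third true  false c d = refl
∧-pull-third true  true  c d = ∧-comm c d

∧-interchange-head : ∀ a b c d → a ∧ (b ∧ (c ∧ d)) ≡ (b ∧ c) ∧ (a ∧ d)
∧-interchange-head true  b c d = sym (∧-assoc b c d)
∧-interchange-head false b c d = sym (∧-zeroʳ (b ∧ c))

∧-absorb-implied : ∀ {a b c} → (T a → T b → T c) → a ∧ b ≡ a ∧ (b ∧ c)
∧-absorb-implied {false}         _   = refl
∧-absorb-implied {true}  {false} _   = refl
∧-absorb-implied {true}  {true}  a⇒c = sym (to T-≡ (a⇒c _ _))

all-true : ∀ {a} {A : Set a} (xs : List A) → all (λ _ → true) xs ≡ true
all-true []       = refl
all-true (_ ∷ xs) = all-true xs

module _ {a} {A : Set a} where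

  longest : (List A → Bool) → List (List A) → ℕ
  longest p = foldr (λ xs acc → if p xs then length xs ⊔ acc else acc) 2

  2≤longest : ∀ p L → 2 ≤ longest p L
  2≤longest p [] = ≤-refl
  2≤longest p (ys ∷ L) with p ys
  ... | true  = ≤-trans (2≤longest p L) (m≤n⊔m (length ys) _)
  ... | false = 2≤longest p L

  length≤longest : ∀ p {L xs} → xs ∈ L → T (p xs) → length xs ≤ longest p L
  length≤longest p {xs ∷ L} (here refl) pxs with p xs
  ... | true = m≤m⊔n (length xs) _
  length≤longest p {ys ∷ L} (there xs∈L) pxs with p ys
  ... | true  = ≤-trans (length≤longest p xs∈L pxs) (m≤n⊔m (length ys) _)
  ... | false = length≤longest p xs∈L pxs

  longest-attained : ∀ p L →
                     longest p L ≡ 2 ⊎ ∃[ xs ] (xs ∈ L × T (p xs) × length xs ≡ longest p L)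
  longest-attained p [] = inj₁ refl
  longest-attained p (ys ∷ L) with p ys in pys | longest-attained p L
  ... | false | inj₁ ≡2 = inj₁ ≡2
  ... | false | inj₂ (xs , xs∈L , pxs , len≡) = inj₂ (xs , there xs∈L , pxs , len≡)
  ... | true | ih with ≤-total (length ys) (longest p L)
  ...   | inj₂ ys≥ = inj₂ (ys , here refl , from T-≡ pys , sym (m≥n⇒m⊔n≡m ys≥))
  ...   | inj₁ ys≤ with ih
  ...     | inj₁ ≡2 = inj₁ (trans (m≤n⇒m⊔n≡n ys≤) ≡2)
  ...     | inj₂ (xs , xs∈L , pxs , len≡) =
              inj₂ (xs , there xs∈L , pxs , trans len≡ (sym (m≤n⇒m⊔n≡n ys≤)))

  longest-≤ : ∀ p q L → (∀ {xs} → xs ∈ L → T (p xs) → length xs ≡ longest p L → T (q xs)) →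
              longest p L ≤ longest q L
  longest-≤ p q L longest-p⇒q with longest-attained p L
  ... | inj₁ ≡2 = subst (_≤ longest q L) (sym ≡2) (2≤longest q L)
  ... | inj₂ (xs , xs∈L , pxs , len≡) =
          subst (_≤ longest q L) len≡ (length≤longest q xs∈L (longest-p⇒q xs∈L pxs len≡))

  -- `verts G S`, `maxc G S` and the sum in `bound` are, by definition, `select S (allFin n)`
  -- and `maxOver`/`sumOver` over it.
  select : (A → Bool) → List A → List A
  select P = foldr (λ v acc → if P v then v ∷ acc else acc) []

  sumOver : (A → ℚ) → List A → ℚ
  sumOver f = foldr (λ v acc → f v + acc) 0ℚ

  maxOver : (A → ℕ) → List A → ℕ
  maxOver f = foldr (λ v acc → f v ⊔ acc) 0

  select-true : ∀ L → select (λ _ → true) L ≡ L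
  select-true []      = refl
  select-true (v ∷ L) = cong (v ∷_) (select-true L)

  module _ (s : ℕ) (h : A → ℕ) where

    sumOver-select-≥ : ∀ {f g : A → ℚ} →
                       (∀ v → s ≤ h v → g v ≡ f v) → (∀ v → h v < s → f v ≡ 0ℚ) →
                       ∀ L → sumOver f L ≡ sumOver g (select (λ v → s ≤ᵇ h v) L)
    sumOver-select-≥ g≡f f≡0 [] = refl
    sumOver-select-≥ {f} {g} g≡f f≡0 (v ∷ L) with s ≤ᵇ h v | ≤ᵇ-reflects-≤ s (h v)
    ... | true  | ofʸ s≤hv = cong₂ _+_ (sym (g≡f v s≤hv)) (sumOver-select-≥ g≡f f≡0 L)
    ... | false | ofⁿ s≰hv = begin
      f v + sumOver f L
        ≡⟨ cong₂ _+_ (f≡0 v (≰⇒> s≰hv)) (sumOver-select-≥ g≡f f≡0 L) ⟩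
      0ℚ + sumOver g L≥
        ≡⟨ +-identityˡ (sumOver g L≥) ⟩
      sumOver g L≥ ∎
      where
      open ≡-Reasoning
      L≥ = select (λ v → s ≤ᵇ h v) L

    select-≥-empty : ∀ L → maxOver h L < s → select (λ v → s ≤ᵇ h v) L ≡ []
    select-≥-empty [] _ = refl
    select-≥-empty (v ∷ L) max<s with s ≤ᵇ h v | ≤ᵇ-reflects-≤ s (h v)
    ... | true  | ofʸ s≤hv = ⊥-elim (<⇒≱ max<s (≤-trans s≤hv (m≤m⊔n (h v) _)))
    ... | false | _        = select-≥-empty L (≤-<-trans (m≤n⊔m (h v) _) max<s)

    maxOver-select-≥ : ∀ {g : A → ℕ} → (∀ v → s ≤ h v → g v ≡ h v) →
                       ∀ L → s ≤ maxOver h L → maxOver g (select (λ v → s ≤ᵇ h v) L) ≡ maxOver h L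
    maxOver-select-≥ g≡h [] _ = refl
    maxOver-select-≥ {g} g≡h (v ∷ L) s≤max with s ≤ᵇ h v | ≤ᵇ-reflects-≤ s (h v)
    ... | false | ofⁿ s≰hv =
      trans (maxOver-select-≥ g≡h L s≤maxL) (sym (m≤n⇒m⊔n≡n (≤-trans (<⇒≤ hv<s) s≤maxL)))
      where
      hv<s = ≰⇒> s≰hv
      s≤maxL : s ≤ maxOver h L
      s≤maxL = ≮⇒≥ (λ maxL<s → <⇒≱ (⊔-pres-<m hv<s maxL<s) s≤max)
    ... | true  | ofʸ s≤hv with s ≤? maxOver h L
    ...   | yes s≤maxL = cong₂ _⊔_ (g≡h v s≤hv) (maxOver-select-≥ g≡h L s≤maxL)
    ...   | no s≰maxL = begin
      g v ⊔ maxOver g (select (λ v → s ≤ᵇ h v) L)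
        ≡⟨ cong₂ _⊔_ (g≡h v s≤hv) (cong (maxOver g) (select-≥-empty L maxL<s)) ⟩
      h v ⊔ 0
        ≡⟨ ⊔-identityʳ (h v) ⟩
      h v
        ≡⟨ sym (m≥n⇒m⊔n≡m (≤-trans (<⇒≤ maxL<s) s≤hv)) ⟩
      h v ⊔ maxOver h L ∎
      where
      open ≡-Reasoning
      maxL<s = ≰⇒> s≰maxL

module _ {n : ℕ} (G : Graph n) where

  -- Defs declares these functions in a module parameterised by the vertex set although they
  -- never use it, so e.g. `lists G S k` and `lists G S′ k` are not definitionally equal.
  lists-vset-irrelevant : ∀ S S′ k → lists G S k ≡ lists G S′ k
  lists-vset-irrelevant S S′ 0       = refl
  lists-vset-irrelevant S S′ (suc k) =
    cong (concatMap (λ xs → map (_∷ xs) (allFin n))) (lists-vset-irrelevant S S′ k)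

  candidates-vset-irrelevant : ∀ S S′ → candidates G S ≡ candidates G S′
  candidates-vset-irrelevant S S′ =
    cong concat (map-cong (lists-vset-irrelevant S S′) (upTo (suc n)))

  distinctB-vset-irrelevant : ∀ S S′ xs → distinctB G S xs ≡ distinctB G S′ xs
  distinctB-vset-irrelevant S S′ []       = refl
  distinctB-vset-irrelevant S S′ (x ∷ xs) =
    cong (not (memB G S x xs) ∧_) (distinctB-vset-irrelevant S S′ xs)

  closedB-vset-irrelevant : ∀ S S′ v xs → closedB G S v xs ≡ closedB G S′ v xs
  closedB-vset-irrelevant S S′ v []           = refl
  closedB-vset-irrelevant S S′ v (x ∷ [])     = refl
  closedB-vset-irrelevant S S′ v (x ∷ y ∷ xs) =
    cong (adj G x y ∧_) (closedB-vset-irrelevant S S′ v (y ∷ xs))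

  subsets-vset-irrelevant : ∀ S S′ xs → subsets G S xs ≡ subsets G S′ xs
  subsets-vset-irrelevant S S′ []       = refl
  subsets-vset-irrelevant S S′ (x ∷ xs) =
    cong (λ ts → ts ++ map (x ∷_) ts) (subsets-vset-irrelevant S S′ xs)

  countB-cong : ∀ S S′ {p q} L → (∀ {t} → t ∈ L → p t ≡ q t) →
                countB G S L p ≡ countB G S′ L q
  countB-cong S S′ []      p≡q = refl
  countB-cong S S′ {p} {q} (t ∷ L) p≡q rewrite p≡q (here refl) with q t
  ... | true  = cong suc (countB-cong S S′ L (p≡q ∘ there))
  ... | false = countB-cong S S′ L (p≡q ∘ there)

  memB⇒∈ : ∀ S {v} xs → T (memB G S v xs) → v ∈ xs
  memB⇒∈ S xs = Any.map (sym ∘ toWitness) ∘ any⁻ _ xs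

  ∈⇒memB : ∀ S {v xs} → v ∈ xs → T (memB G S v xs)
  ∈⇒memB S = any⁺ _ ∘ Any.map (fromWitness ∘ sym)

  isCycleB-restrict : ∀ S xs → isCycleB G S xs ≡ isCycleB G full xs ∧ all S xs
  isCycleB-restrict S []       = refl
  isCycleB-restrict S (x ∷ xs) = begin
    long ∧ (distinctB G S (x ∷ xs) ∧ (inS ∧ closedB G S x (x ∷ xs)))
      ≡⟨ cong₂ (λ d c → long ∧ (d ∧ (inS ∧ c)))
               (distinctB-vset-irrelevant S full (x ∷ xs)) (closedB-vset-irrelevant S full x (x ∷ xs)) ⟩
    long ∧ (distinct ∧ (inS ∧ closed))
      ≡⟨ ∧-pull-third long distinct inS closed ⟩
    (long ∧ (distinct ∧ closed)) ∧ inS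
      ≡⟨ cong (λ b → (long ∧ (distinct ∧ (b ∧ closed))) ∧ inS) (sym (all-true (x ∷ xs))) ⟩
    isCycleB G full (x ∷ xs) ∧ inS ∎
    where
    open ≡-Reasoning
    long     = 3 ≤ᵇ length (x ∷ xs)
    inS      = all S (x ∷ xs)
    distinct = distinctB G full (x ∷ xs)
    closed   = closedB G full x (x ∷ xs)

  cliqueB-restrict : ∀ S t → cliqueB G S t ≡ cliqueB G full t ∧ all S t
  cliqueB-restrict S []      = refl
  cliqueB-restrict S (x ∷ t) = begin
    S x ∧ (all (adj G x) t ∧ cliqueB G S t)
      ≡⟨ cong (λ b → S x ∧ (all (adj G x) t ∧ b)) (cliqueB-restrict S t) ⟩
    S x ∧ (all (adj G x) t ∧ (cliqueB G full t ∧ all S t))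
      ≡⟨ ∧-interchange-head (S x) (all (adj G x) t) (cliqueB G full t) (all S t) ⟩
    (all (adj G x) t ∧ cliqueB G full t) ∧ (S x ∧ all S t) ∎
    where open ≡-Reasoning

  clique⇒all : ∀ S t → T (cliqueB G S t) → T (all S t)
  clique⇒all S t cl = proj₂ (to (T-∧ {cliqueB G full t}) (subst T (cliqueB-restrict S t) cl))

  cliqueB-∷⁻ : ∀ S x t → T (cliqueB G S (x ∷ t)) → All (T ∘ adj G x) t × T (cliqueB G S t)
  cliqueB-∷⁻ S x t cl =
    let _ , rest = to (T-∧ {S x}) cl
        adjs , cl′ = to (T-∧ {all (adj G x) t}) rest
    in all⁺ (adj G x) t adjs , cl′

  clique⇒distinctB : ∀ S t → T (cliqueB G S t) → T (distinctB G S t)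
  clique⇒distinctB S []      _  = _
  clique⇒distinctB S (x ∷ t) cl = from T-∧ (x∉t , clique⇒distinctB S t cl′)
    where
    adjs = proj₁ (cliqueB-∷⁻ S x t cl)
    cl′  = proj₂ (cliqueB-∷⁻ S x t cl)
    x∉t : T (not (memB G S x t))
    x∉t with memB G S x t in x∈t
    ... | false = _
    ... | true  = subst T (irrefl G x) (All.lookup adjs (memB⇒∈ S t (from T-≡ x∈t)))

  clique⇒closedB : ∀ S f {x t} → T (cliqueB G S (x ∷ t)) → All (λ w → T (adj G w f)) (x ∷ t) →
                   T (closedB G S f (x ∷ t))
  clique⇒closedB S f {x} {[]}    _  (x~f ∷ []) = x~f
  clique⇒closedB S f {x} {y ∷ t} cl (_ ∷ ~f)  =
    let x~ , cl′ = cliqueB-∷⁻ S x (y ∷ t) cl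
    in from T-∧ (All.head x~ , clique⇒closedB S f cl′ ~f)

  clique⇒cycle : ∀ S t → 3 ≤ length t → T (cliqueB G S t) → T (isCycleB G S t)
  clique⇒cycle S (_ ∷ []) (s≤s ()) _
  clique⇒cycle S (x ∷ y ∷ t) 3≤len cl =
    from T-∧ (≤⇒≤ᵇ 3≤len ,
      from T-∧ (clique⇒distinctB S (x ∷ y ∷ t) cl , from T-∧ (clique⇒all S (x ∷ y ∷ t) cl , closed)))
    where
    adjs : All (T ∘ adj G x) (y ∷ t)
    adjs = proj₁ (cliqueB-∷⁻ S x (y ∷ t) cl)
    closed : T (closedB G S x (x ∷ y ∷ t))
    closed = from T-∧ (All.head adjs ,
                       clique⇒closedB S x {y} {t} (proj₂ (cliqueB-∷⁻ S x (y ∷ t) cl))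
                                      (All.map (λ {w} → subst T (Graph.sym G x w)) adjs))

  subsets-length : ∀ S {xs t} → t ∈ subsets G S xs → length t ≤ length xs
  subsets-length S {[]}     (here refl) = z≤n
  subsets-length S {x ∷ xs} t∈ with ∈-++⁻ (subsets G S xs) t∈
  ... | inj₁ t∈ₗ = ≤-trans (subsets-length S {xs} t∈ₗ) (n≤1+n (length xs))
  ... | inj₂ t∈ᵣ with ∈-map⁻ (x ∷_) t∈ᵣ
  ...   | u , u∈ , refl = s≤s (subsets-length S {xs} u∈)

  lists-complete : ∀ S t → t ∈ lists G S (length t)
  lists-complete S []      = here refl
  lists-complete S (x ∷ t) =
    ∈-concat⁺′ (∈-map⁺ (_∷ t) (∈-allFin x))
               (∈-map⁺ (λ xs → map (_∷ xs) (allFin n)) (lists-complete S t))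

  candidates-complete : ∀ S {t} → length t ≤ n → t ∈ candidates G S
  candidates-complete S {t} len≤n =
    ∈-concat⁺′ (lists-complete S t) (∈-map⁺ (lists G S) (∈-upTo⁺ (s≤s len≤n)))

  -- `c G S v` is, by definition, `longest (cycleThroughB S v) (candidates G S)`.
  cycleThroughB : VSet n → Fin n → List (Fin n) → Bool
  cycleThroughB S v xs = isCycleB G S xs ∧ memB G S v xs

  cycle-length≤c : ∀ S {v xs} → xs ∈ candidates G S → T (isCycleB G S xs) → v ∈ xs →
                   length xs ≤ c G S v
  cycle-length≤c S {v} xs∈ cyc v∈xs =
    length≤longest (cycleThroughB S v) xs∈ (from T-∧ (cyc , ∈⇒memB S v∈xs))

  clique-length≤c : ∀ S {t w} → length t ≤ n → T (cliqueB G S t) → w ∈ t → length t ≤ c G S w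
  clique-length≤c S {t} {w} len≤n cl w∈t with 3 ≤? length t
  ... | yes 3≤len = cycle-length≤c S (candidates-complete S len≤n) (clique⇒cycle S t 3≤len cl) w∈t
  ... | no  3≰len = ≤-trans (≤-pred (≰⇒> 3≰len)) (2≤longest (cycleThroughB S w) (candidates G S))

  c-restrict : ∀ S v → (∀ w → c G full v ≤ c G full w → T (S w)) → c G S v ≡ c G full v
  c-restrict S v c-large⇒S = begin
    c G S v
      ≡⟨ cong (longest (cycleThroughB S v)) (candidates-vset-irrelevant S full) ⟩
    longest (cycleThroughB S v) Cyc
      ≡⟨ ≤-antisym (longest-≤ (cycleThroughB S v) (cycleThroughB full v) Cyc restricted⇒full)
                   (longest-≤ (cycleThroughB full v) (cycleThroughB S v) Cyc longest⇒restricted) ⟩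
    c G full v ∎
    where
    open ≡-Reasoning
    Cyc = candidates G full

    restricted⇒full : ∀ {xs} → xs ∈ Cyc → T (cycleThroughB S v xs) →
                      length xs ≡ longest (cycleThroughB S v) Cyc → T (cycleThroughB full v xs)
    restricted⇒full {xs} _ thr _ =
      let cyc , v∈ = to T-∧ thr
      in from T-∧ (proj₁ (to T-∧ (subst T (isCycleB-restrict S xs) cyc)) , v∈)

    -- each vertex w of a longest cycle through v lies on a cycle of length c v, so c v ≤ c w
    longest⇒restricted : ∀ {xs} → xs ∈ Cyc → T (cycleThroughB full v xs) →
                         length xs ≡ c G full v → T (cycleThroughB S v xs)
    longest⇒restricted {xs} xs∈ thr len≡ =
      let cyc , v∈ = to T-∧ thr
          inS = all⁻ S (All.tabulate λ {w} w∈ →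
                  c-large⇒S w (subst (_≤ c G full w) len≡ (cycle-length≤c full xs∈ cyc w∈)))
      in from T-∧ (subst T (sym (isCycleB-restrict S xs)) (from T-∧ (cyc , inS)) , v∈)

  weight-below : ∀ S {s k} → k < s → weight G S s k ≡ 0ℚ
  weight-below S {s} {k} k<s rewrite k>n⇒nCk≡0 k<s = 0/n≡0 (suc (k ∸ 2))

module _ {n : ℕ} (G : Graph n) (s : ℕ) where

  -- `with verts G S` in `bound-as-opaque` normalises the whole goal. Keeping its right-hand
  -- side opaque stops the `verts G S` hidden inside `maxc G S` from being abstracted too, and
  -- keeps the normal forms (full unfoldings of ℚ arithmetic) out of the right-hand side.
  opaque
    weightSumᵒ : VSet n → List (Fin n) → ℚ
    weightSumᵒ S = sumOver (λ v → weight G S s (c G S v))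

    weightSumᵒ-unfold : ∀ S L → weightSumᵒ S L ≡ sumOver (λ v → weight G S s (c G S v)) L
    weightSumᵒ-unfold S L = refl

    subtractedᵒ : VSet n → List (Fin n) → ℚ
    subtractedᵒ S []      = 0ℚ
    subtractedᵒ S (_ ∷ _) = weight G S s (maxc G S)

    subtractedᵒ-[] : ∀ S → subtractedᵒ S [] ≡ 0ℚ
    subtractedᵒ-[] S = refl

    subtractedᵒ-∷ : ∀ S x xs → subtractedᵒ S (x ∷ xs) ≡ weight G S s (maxc G S)
    subtractedᵒ-∷ S x xs = refl

    subtractedᵒ-verts : 1 ≤ s → ∀ S → subtractedᵒ S (verts G S) ≡ weight G S s (maxc G S)
    subtractedᵒ-verts 1≤s S = go (verts G S) refl
      where
      go : ∀ L → verts G S ≡ L → subtractedᵒ S L ≡ weight G S s (maxc G S)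
      go []      verts≡[] = trans (sym (weight-below G S 1≤s))
                                  (cong (λ L → weight G S s (maxOver (c G S) L)) (sym verts≡[]))
      go (_ ∷ _) _        = refl

  bound-as-opaque : ∀ S → bound G S s ≡ weightSumᵒ S (verts G S) - subtractedᵒ S (verts G S)
  bound-as-opaque S with verts G S
  ... | []     = cong₂ _-_ (sym (weightSumᵒ-unfold S [])) (sym (subtractedᵒ-[] S))
  ... | x ∷ xs = cong₂ _-_ (sym (weightSumᵒ-unfold S (x ∷ xs))) (sym (subtractedᵒ-∷ S x xs))

  bound-unfold : 1 ≤ s → ∀ S →
                 bound G S s ≡ sumOver (λ v → weight G S s (c G S v)) (verts G S) - weight G S s (maxc G S)
  bound-unfold 1≤s S =
    trans (bound-as-opaque S) (cong₂ _-_ (weightSumᵒ-unfold S (verts G S)) (subtractedᵒ-verts 1≤s S))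

module _ {n : ℕ} (G : Graph n) (s : ℕ) where

  private
    H = Hc G s
    V = allFin n

  c-Hc : ∀ {v} → s ≤ c G full v → c G H v ≡ c G full v
  c-Hc s≤cv = c-restrict G H _ (λ w cv≤cw → ≤⇒≤ᵇ (≤-trans s≤cv cv≤cw))

  clique-in-Hc : ∀ {t} → length t ≡ s → length t ≤ n → T (cliqueB G full t) → T (all H t)
  clique-in-Hc {t} len≡s len≤n cl =
    all⁻ H (All.tabulate λ {w} w∈t →
      ≤⇒≤ᵇ (subst (_≤ c G full w) len≡s (clique-length≤c G full {t} len≤n cl w∈t)))

  NK-Hc : NK G full s ≡ NK G H s
  NK-Hc = begin
    countB G full (subsets G full V) (sizeClique full)
      ≡⟨ countB-cong G full H (subsets G full V) same-cliques ⟩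
    countB G H (subsets G full V) (sizeClique H)
      ≡⟨ cong (λ L → countB G H L (sizeClique H)) (subsets-vset-irrelevant G full H V) ⟩
    countB G H (subsets G H V) (sizeClique H) ∎
    where
    open ≡-Reasoning
    sizeClique : VSet n → List (Fin n) → Bool
    sizeClique S t = (length t ≡ᵇ s) ∧ cliqueB G S t
    same-cliques : ∀ {t} → t ∈ subsets G full V → sizeClique full t ≡ sizeClique H t
    same-cliques {t} t∈ = trans
      (∧-absorb-implied {length t ≡ᵇ s} {cliqueB G full t} {all H t}
        λ len≡s cl → clique-in-Hc {t} (≡ᵇ⇒≡ _ _ len≡s) len≤n cl)
      (cong ((length t ≡ᵇ s) ∧_) (sym (cliqueB-restrict G H t)))
      where
      len≤n = subst (length t ≤_) (length-tabulate (λ i → i)) (subsets-length G full {V} t∈)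

  weightSum-Hc : sumOver (λ v → weight G full s (c G full v)) (verts G full) ≡
                 sumOver (λ v → weight G H s (c G H v)) (verts G H)
  weightSum-Hc = trans (cong (sumOver (λ v → weight G full s (c G full v))) (select-true V))
    (sumOver-select-≥ s (c G full) {g = λ v → weight G H s (c G H v)}
       (λ v s≤cv → cong (weight G H s) (c-Hc s≤cv)) (λ v cv<s → weight-below G full cv<s) V)

  maxWeight-Hc : 1 ≤ s → weight G full s (maxc G full) ≡ weight G H s (maxc G H)
  maxWeight-Hc 1≤s = by-cases (s ≤? maxOver (c G full) V)
    where
    maxc-full : maxc G full ≡ maxOver (c G full) V
    maxc-full = cong (maxOver (c G full)) (select-true V)
    by-cases : Dec (s ≤ maxOver (c G full) V) → weight G full s (maxc G full) ≡ weight G H s (maxc G H)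
    by-cases (yes s≤max) =
      cong (weight G full s) (trans maxc-full (sym (maxOver-select-≥ s (c G full) (λ v → c-Hc) V s≤max)))
    by-cases (no s≰max) = begin
      weight G full s (maxc G full)
        ≡⟨ cong (weight G full s) maxc-full ⟩
      weight G full s (maxOver (c G full) V)
        ≡⟨ weight-below G full (≰⇒> s≰max) ⟩
      0ℚ
        ≡⟨ sym (weight-below G H 1≤s) ⟩
      weight G H s 0
        ≡⟨ cong (λ L → weight G H s (maxOver (c G H) L)) (sym (select-≥-empty s (c G full) V (≰⇒> s≰max))) ⟩
      weight G H s (maxc G H) ∎
      where open ≡-Reasoning

  bound-Hc : 1 ≤ s → bound G full s ≡ bound G H s
  bound-Hc 1≤s = begin
    bound G full s
      ≡⟨ bound-unfold G s 1≤s full ⟩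
    sumOver (λ v → weight G full s (c G full v)) (verts G full) - weight G full s (maxc G full)
      ≡⟨ cong₂ _-_ weightSum-Hc (maxWeight-Hc 1≤s) ⟩
    sumOver (λ v → weight G H s (c G H v)) (verts G H) - weight G H s (maxc G H)
      ≡⟨ sym (bound-unfold G s 1≤s H) ⟩
    bound G H s ∎
    where open ≡-Reasoning

lemma2p36 : (n : ℕ) (G : Graph n) (s : ℕ) → 1 ≤ s →
    AttainsEq G full s ⇔ AttainsEq G (Hc G s) s
lemma2p36 n G s 1≤s =
  mk⇔ (subst₂ Attains (NK-Hc G s) (bound-Hc G s 1≤s))
      (subst₂ Attains (sym (NK-Hc G s)) (sym (bound-Hc G s 1≤s)))
  where
  Attains : ℕ → ℚ → Set
  Attains k q = (+ k) / 1 ≡ q
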